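{- Let $(\alpha_n)$ and $(\beta_n)$ be sequences of nonnegative real numbers and let $r$ be a rate of divergence for $\sum_{i=0}^\infty\alpha_i=\infty$. Let $\varepsilon>0$ and $g:\mathbb{N}\to\mathbb{N}$ be arbitrary. Suppose $N_1,N_2\in\mathbb{N}$ and $\theta>0$ are such that, with $N:=\max\{N_1,N_2\}$, $$\sum_{i=N_1}^{r(N+g(N),\varepsilon/4\theta)}\alpha_i\beta_i\leq\frac{\varepsilon^2}{8\theta}$$ and $$\beta_n-\beta_m\leq\theta\sum_{i=n}^{m-1}\alpha_i+\frac{\varepsilon}{4}\quad\text{for all } N_2\leq n<m\leq r\!\left(N+g(N),\frac{\varepsilon}{4\theta}\right).$$ Then $\beta_n\leq\varepsilon$ for all $n\in[N,N+g(N)]$.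
   Context: $\mathbb{Q}_+$ denotes the strictly positive rationals and $[a,a+b]:=\{a,a+1,\dots,a+b\}$ for natural numbers $a,b$. For a sequence $(b_n)$ of nonnegative reals with $\sum_{i=0}^\infty b_i=\infty$, a rate of divergence is a function $r:\mathbb{N}\times\mathbb{Q}_+\to\mathbb{N}$ such that $\sum_{i=n}^{r(n,x)}b_i\geq x$ for all $n\in\mathbb{N}$ and $x\in\mathbb{Q}_+$, and which is moreover monotone in its first argument: $m\leq n$ implies $r(m,x)\leq r(n,x)$. -}

module Defs where

open import Level using (Level; _⊔_) renaming (suc to lsuc)
open import Data.Nat as ℕ using (ℕ; zero; suc; _∸_)
open import Data.Integer using (+_)
open import Data.Rational as ℚ using (ℚ; Positive; 1/_)
open import Data.Rational.Properties as ℚP using (pos*pos⇒pos; 1/pos⇒pos; pos⇒nonZero)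
open import Data.Product using (Σ; _×_; _,_; proj₁; proj₂)
open import Relation.Nullary using (¬_)
open import Relation.Binary.Structures using (IsTotalOrder)
open import Algebra.Bundles using (CommutativeRing)

ℚ₊ : Set
ℚ₊ = Σ ℚ Positive

_*₊_ : ℚ₊ → ℚ₊ → ℚ₊
(p , pp) *₊ (q , qp) = (p ℚ.* q , pos*pos⇒pos p {{pp}} q {{qp}})

_/₊_ : ℚ₊ → ℚ₊ → ℚ₊
(p , pp) /₊ (q , qp) =
  ( p ℚ.* ((1/ q) {{pos⇒nonZero q {{qp}}}})
  , pos*pos⇒pos p {{pp}} ((1/ q) {{pos⇒nonZero q {{qp}}}}) {{1/pos⇒pos q {{qp}}}} )

4₊ : ℚ₊
4₊ = (+ 4 ℚ./ 1 , _)

8₊ : ℚ₊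
8₊ = (+ 8 ℚ./ 1 , _)

-- Ordered fields (containing ℚ via the canonical embedding ι).
-- The real numbers are an instance; the statement is proved for every
-- ordered field, in particular for ℝ.

record OrderedField (c ℓ₁ ℓ₂ : Level) : Set (lsuc (c ⊔ ℓ₁ ⊔ ℓ₂)) where
  field
    commutativeRing : CommutativeRing c ℓ₁
  open CommutativeRing commutativeRing public
  infix 4 _≤_
  field
    0≉1       : ¬ (0# ≈ 1#)
    inverse   : ∀ x → ¬ (x ≈ 0#) → Σ Carrier (λ y → x * y ≈ 1#)
    _≤_          : Carrier → Carrier → Set ℓ₂
    isTotalOrder : IsTotalOrder _≈_ _≤_
    +-mono-≤     : ∀ {x y} z → x ≤ y → x + z ≤ y + z
    *-nonneg     : ∀ {x y} → 0# ≤ x → 0# ≤ y → 0# ≤ x * y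
    ι      : ℚ → Carrier
    ι-+    : ∀ p q → ι (p ℚ.+ q) ≈ ι p + ι q
    ι-*    : ∀ p q → ι (p ℚ.* q) ≈ ι p * ι q
    ι-1    : ι ℚ.1ℚ ≈ 1#
    ι-mono : ∀ {p q} → p ℚ.≤ q → ι p ≤ ι q

  sumLen : (ℕ → Carrier) → ℕ → ℕ → Carrier
  sumLen f a zero    = 0#
  sumLen f a (suc k) = f a + sumLen f (suc a) k

  -- Σ[ a , b ] f = ∑_{i=a}^{b} f i   (empty sum = 0 if b < a)
  Σ[_,_]_ : ℕ → ℕ → (ℕ → Carrier) → Carrier
  Σ[ a , b ] f = sumLen f a (suc b ∸ a)

  IsRateOfDivergence : (ℕ → Carrier) → (ℕ → ℚ₊ → ℕ) → Set (ℓ₂)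
  IsRateOfDivergence b r =
    (∀ n (x : ℚ₊) → ι (proj₁ x) ≤ Σ[ n , r n x ] b)
    × (∀ {m n} (x : ℚ₊) → m ℕ.≤ n → r m x ℕ.≤ r n x)

-- Put c = ε/(4θ) and δ = θc + ε/4 = ε/2, and fix n ∈ [N, N + g(N)]. Walk right from n until
-- the α-mass of [n, n+k] first reaches c; since c > 0, the rate of divergence forces this to
-- happen by r(n, c) ≤ r(N + g(N), c). Up to that point the α-mass behind each index is at most
-- c, so the oscillation hypothesis gives β i ≥ β n − δ on the whole window. If β n > δ, then
-- c (β n − δ) ≤ Σ α_i β_i ≤ ε²/(8θ), and ε²/(8θ) + δc = εc turns this into β n ≤ ε.

module Submission where

open import Defs
open import Level using (Level; 0ℓ)
open import Data.Nat as ℕ using (ℕ; zero; suc; z≤n; s≤s; _≤′_; ≤′-refl; ≤′-step)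
import Data.Nat.Properties as ℕP
open import Data.Product using (proj₁; proj₂; _×_; _,_; ∃-syntax)
open import Data.Sum using (_⊎_; inj₁; inj₂)
open import Data.Empty using (⊥-elim)
open import Data.Integer using (+_)
open import Data.Rational as ℚ using (ℚ; 0ℚ; 1ℚ; 1/_)
import Data.Rational.Properties as ℚP
open import Relation.Nullary using (¬_; yes; no)
open import Relation.Nullary.Decidable using (dec⇒maybe)
open import Relation.Binary.Bundles using (TotalOrder)
open import Relation.Binary.PropositionalEquality as ≡ using (_≡_)
open import Tactic.RingSolver.Core.AlmostCommutativeRing using (AlmostCommutativeRing; fromCommutativeRing)
open import Tactic.RingSolver using (solve-∀)

ℚ-ring : AlmostCommutativeRing 0ℓ 0ℓ
ℚ-ring = fromCommutativeRing ℚP.+-*-commutativeRing (λ x → dec⇒maybe (0ℚ ℚ.≟ x))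

module _ where
  open import Data.Rational using (_+_; _*_)

  private
    4ℚ 8ℚ ¼ ½ : ℚ
    4ℚ = proj₁ 4₊
    8ℚ = proj₁ 8₊
    ¼ = 1/ 4ℚ
    ½ = 1/ (+ 2 ℚ./ 1)

    regroup-θ : ∀ e t u → t * (e * u) ≡ (e * ¼) * ((4ℚ * t) * u)
    regroup-θ = solve-∀ ℚ-ring

    regroup-8 : ∀ v t u → v * ((4ℚ * t) * u) ≡ (v * (8ℚ * t)) * (u * ½)
    regroup-8 = solve-∀ ℚ-ring

    halves : ∀ e u → (e * e) * (u * ½) + (e * ¼ + e * ¼) * (e * u) ≡ e * (e * u)
    halves = solve-∀ ℚ-ring

  module _ (ε θ : ℚ₊) where
    private
      e = proj₁ ε
      t = proj₁ θ
      instance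
        4θ≢0 : ℚ.NonZero (4ℚ * t)
        4θ≢0 = ℚP.pos⇒nonZero (4ℚ * t) {{proj₂ (4₊ *₊ θ)}}
        8θ≢0 : ℚ.NonZero (8ℚ * t)
        8θ≢0 = ℚP.pos⇒nonZero (8ℚ * t) {{proj₂ (8₊ *₊ θ)}}
      c = proj₁ (ε /₊ (4₊ *₊ θ))
      u = 1/ (4ℚ * t)
      v = 1/ (8ℚ * t)

      1/8θ≡½/4θ : v ≡ u * ½
      1/8θ≡½/4θ = begin
        v                          ≡⟨ ≡.sym (ℚP.*-identityʳ v) ⟩
        v * 1ℚ                     ≡⟨ ≡.cong (v *_) (ℚP.*-inverseʳ (4ℚ * t)) ⟨
        v * ((4ℚ * t) * u)         ≡⟨ regroup-8 v t u ⟩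
        (v * (8ℚ * t)) * (u * ½)   ≡⟨ ≡.cong (_* (u * ½)) (ℚP.*-inverseˡ (8ℚ * t)) ⟩
        1ℚ * (u * ½)               ≡⟨ ℚP.*-identityˡ (u * ½) ⟩
        u * ½                      ∎
        where open ≡.≡-Reasoning

      θ*[ε/4θ]≡ε/4 : t * c ≡ proj₁ (ε /₊ 4₊)
      θ*[ε/4θ]≡ε/4 = begin
        t * (e * u)                ≡⟨ regroup-θ e t u ⟩
        (e * ¼) * ((4ℚ * t) * u)   ≡⟨ ≡.cong ((e * ¼) *_) (ℚP.*-inverseʳ (4ℚ * t)) ⟩
        (e * ¼) * 1ℚ               ≡⟨ ℚP.*-identityʳ (e * ¼) ⟩
        e * ¼                      ∎
        where open ≡.≡-Reasoning

    ε²/8θ+[θc+ε/4]c≡εc : proj₁ ((ε *₊ ε) /₊ (8₊ *₊ θ)) + (t * c + proj₁ (ε /₊ 4₊)) * c ≡ e * c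
    ε²/8θ+[θc+ε/4]c≡εc = begin
      (e * e) * v + (t * c + e * ¼) * c   ≡⟨ ≡.cong₂ (λ x y → (e * e) * x + (y + e * ¼) * c) 1/8θ≡½/4θ θ*[ε/4θ]≡ε/4 ⟩
      (e * e) * (u * ½) + (e * ¼ + e * ¼) * (e * u) ≡⟨ halves e u ⟩
      e * c                               ∎
      where open ≡.≡-Reasoning

crossing : ∀ {a b} {A : ℕ → Set a} {B : ℕ → Set b} → (∀ j → A j ⊎ B j) →
           A 0 → ∀ m → B (suc m) → ∃[ k ] k ℕ.≤ m × A k × B (suc k)
crossing A⊎B A0 zero    B1 = 0 , z≤n , A0 , B1
crossing A⊎B A0 (suc m) B[2+m] with A⊎B (suc m)
... | inj₁ A[1+m] = suc m , ℕP.≤-refl , A[1+m] , B[2+m]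
... | inj₂ B[1+m] with crossing A⊎B A0 m B[1+m]
...   | k , k≤m , Ak , B[1+k] = k , ℕP.m≤n⇒m≤1+n k≤m , Ak , B[1+k]

module OrderedFieldProperties {ℓ ℓ₁ ℓ₂ : Level} (F : OrderedField ℓ ℓ₁ ℓ₂) where
  open OrderedField F
  open import Algebra.Properties.Ring ring using (x+x≈x⇒x≈0; x[y-z]≈xy-xz)
  open import Algebra.Properties.Group +-group using (//-rightDividesˡ; //-rightDividesʳ)

  ≤-totalOrder : TotalOrder ℓ ℓ₁ ℓ₂
  ≤-totalOrder = record { isTotalOrder = isTotalOrder }

  open TotalOrder ≤-totalOrder public using (total; antisym)
    renaming (refl to ≤-refl; trans to ≤-trans; reflexive to ≤-reflexive)
  open import Relation.Binary.Reasoning.PartialOrder (TotalOrder.poset ≤-totalOrder)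

  +-monoʳ-≤ : ∀ {x y} z → x ≤ y → z + x ≤ z + y
  +-monoʳ-≤ {x} {y} z x≤y = begin
    z + x  ≈⟨ +-comm z x ⟩
    x + z  ≤⟨ +-mono-≤ z x≤y ⟩
    y + z  ≈⟨ +-comm y z ⟩
    z + y  ∎

  +-mono₂-≤ : ∀ {x y u v} → x ≤ y → u ≤ v → x + u ≤ y + v
  +-mono₂-≤ {y = y} {u} x≤y u≤v = ≤-trans (+-mono-≤ u x≤y) (+-monoʳ-≤ y u≤v)

  x≤y⇒0≤y-x : ∀ {x y} → x ≤ y → 0# ≤ y - x
  x≤y⇒0≤y-x {x} {y} x≤y = begin
    0#     ≈⟨ -‿inverseʳ x ⟨
    x - x  ≤⟨ +-mono-≤ (- x) x≤y ⟩
    y - x  ∎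

  0≤y-x⇒x≤y : ∀ {x y} → 0# ≤ y - x → x ≤ y
  0≤y-x⇒x≤y {x} {y} 0≤y-x = begin
    x             ≈⟨ +-identityˡ x ⟨
    0# + x        ≤⟨ +-mono-≤ x 0≤y-x ⟩
    (y - x) + x   ≈⟨ //-rightDividesˡ x y ⟩
    y             ∎

  x-y≤z⇒x-z≤y : ∀ {x y z} → x - y ≤ z → x - z ≤ y
  x-y≤z⇒x-z≤y {x} {y} {z} x-y≤z = begin
    x - z             ≈⟨ +-congʳ (//-rightDividesˡ y x) ⟨
    ((x - y) + y) - z ≤⟨ +-mono-≤ (- z) (+-mono-≤ y x-y≤z) ⟩
    (z + y) - z       ≈⟨ +-congʳ (+-comm z y) ⟩
    (y + z) - z       ≈⟨ //-rightDividesʳ z y ⟩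
    y                 ∎

  *-monoˡ-≤-nonNeg : ∀ {a x y} → 0# ≤ a → x ≤ y → a * x ≤ a * y
  *-monoˡ-≤-nonNeg {a} {x} {y} 0≤a x≤y = 0≤y-x⇒x≤y (begin
    0#             ≤⟨ *-nonneg 0≤a (x≤y⇒0≤y-x x≤y) ⟩
    a * (y - x)    ≈⟨ x[y-z]≈xy-xz a y x ⟩
    a * y - a * x  ∎)

  *-monoʳ-≤-nonNeg : ∀ {a x y} → 0# ≤ a → x ≤ y → x * a ≤ y * a
  *-monoʳ-≤-nonNeg {a} {x} {y} 0≤a x≤y = begin
    x * a  ≈⟨ *-comm x a ⟩
    a * x  ≤⟨ *-monoˡ-≤-nonNeg 0≤a x≤y ⟩
    a * y  ≈⟨ *-comm a y ⟩
    y * a  ∎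

  +-nonNeg : ∀ {x y} → 0# ≤ x → 0# ≤ y → 0# ≤ x + y
  +-nonNeg 0≤x 0≤y = ≤-trans (≤-reflexive (sym (+-identityʳ 0#))) (+-mono₂-≤ 0≤x 0≤y)

  ι-0 : ι 0ℚ ≈ 0#
  ι-0 = x+x≈x⇒x≈0 (ι 0ℚ) (sym (ι-+ 0ℚ 0ℚ))

  ι-nonNeg : (q : ℚ₊) → 0# ≤ ι (proj₁ q)
  ι-nonNeg (q , q>0) = begin
    0#    ≈⟨ ι-0 ⟨
    ι 0ℚ  ≤⟨ ι-mono (ℚP.<⇒≤ (ℚP.positive⁻¹ q {{q>0}})) ⟩
    ι q   ∎

  ι-*-inverseʳ : ∀ q .{{_ : ℚ.NonZero q}} → ι q * ι (1/ q) ≈ 1#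
  ι-*-inverseʳ q = begin-equality
    ι q * ι (1/ q)   ≈⟨ ι-* q (1/ q) ⟨
    ι (q ℚ.* 1/ q)   ≡⟨ ≡.cong ι (ℚP.*-inverseʳ q) ⟩
    ι 1ℚ             ≈⟨ ι-1 ⟩
    1#               ∎

  ι-≰-0 : (q : ℚ₊) → ¬ (ι (proj₁ q) ≤ 0#)
  ι-≰-0 (q , q>0) ιq≤0 = 0≉1 (begin-equality
    0#               ≈⟨ zeroˡ (ι (1/ q)) ⟨
    0# * ι (1/ q)    ≈⟨ *-congʳ (antisym ιq≤0 (ι-nonNeg (q , q>0))) ⟨
    ι q * ι (1/ q)   ≈⟨ ι-*-inverseʳ q ⟩
    1#               ∎)
    where instance _ = ℚP.pos⇒nonZero q {{q>0}}

  *-cancelʳ-≤-pos : (q : ℚ₊) → ∀ {x y} → x * ι (proj₁ q) ≤ y * ι (proj₁ q) → x ≤ y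
  *-cancelʳ-≤-pos (q , q>0) {x} {y} xq≤yq = begin
    x                      ≈⟨ *-identityʳ x ⟨
    x * 1#                 ≈⟨ *-congˡ (ι-*-inverseʳ q) ⟨
    x * (ι q * ι (1/ q))   ≈⟨ *-assoc x (ι q) (ι (1/ q)) ⟨
    (x * ι q) * ι (1/ q)   ≤⟨ *-monoʳ-≤-nonNeg (ι-nonNeg (1/ q , ℚP.1/pos⇒pos q {{q>0}})) xq≤yq ⟩
    (y * ι q) * ι (1/ q)   ≈⟨ *-assoc y (ι q) (ι (1/ q)) ⟩
    y * (ι q * ι (1/ q))   ≈⟨ *-congˡ (ι-*-inverseʳ q) ⟩
    y * 1#                 ≈⟨ *-identityʳ y ⟩
    y                      ∎
    where instance _ = ℚP.pos⇒nonZero q {{q>0}}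

  module _ {f : ℕ → Carrier} (f≥0 : ∀ i → 0# ≤ f i) where

    sumLen-nonNeg : ∀ a L → 0# ≤ sumLen f a L
    sumLen-nonNeg a zero    = ≤-refl
    sumLen-nonNeg a (suc L) = +-nonNeg (f≥0 a) (sumLen-nonNeg (suc a) L)

    sumLen-mono-length : ∀ a {q L} → q ℕ.≤ L → sumLen f a q ≤ sumLen f a L
    sumLen-mono-length a {L = L} z≤n = sumLen-nonNeg a L
    sumLen-mono-length a (s≤s q≤L)   = +-monoʳ-≤ (f a) (sumLen-mono-length (suc a) q≤L)

    sumLen-mono-window : ∀ {a b} q L → a ≤′ b → b ℕ.+ q ℕ.≤ a ℕ.+ L → sumLen f b q ≤ sumLen f a L
    sumLen-mono-window {a} q L ≤′-refl a+q≤a+L = sumLen-mono-length a (ℕP.+-cancelˡ-≤ a q L a+q≤a+L)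
    sumLen-mono-window {b = suc b} q L (≤′-step a≤′b) b+q<a+L = begin
      sumLen f (suc b) q              ≈⟨ +-identityˡ _ ⟨
      0# + sumLen f (suc b) q         ≤⟨ +-mono-≤ _ (f≥0 b) ⟩
      sumLen f b (suc q)              ≤⟨ sumLen-mono-window (suc q) L a≤′b
                                           (ℕP.≤-trans (ℕP.≤-reflexive (ℕP.+-suc b q)) b+q<a+L) ⟩
      sumLen f _ L                    ∎

    sumLen≤Σ : ∀ {a b e} q → a ℕ.≤ b → b ℕ.+ q ℕ.≤ e → sumLen f b (suc q) ≤ Σ[ a , e ] f
    sumLen≤Σ {a} {b} {e} q a≤b b+q≤e =
      sumLen-mono-window (suc q) (suc e ℕ.∸ a) (ℕP.≤⇒≤′ a≤b) b+1+q≤a+[1+e-a]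
      where
      a≤1+e : a ℕ.≤ suc e
      a≤1+e = ℕP.m≤n⇒m≤1+n (ℕP.≤-trans a≤b (ℕP.≤-trans (ℕP.m≤m+n b q) b+q≤e))
      b+1+q≤a+[1+e-a] : b ℕ.+ suc q ℕ.≤ a ℕ.+ (suc e ℕ.∸ a)
      b+1+q≤a+[1+e-a] = ℕP.≤-trans (ℕP.≤-reflexive (ℕP.+-suc b q))
                          (ℕP.≤-trans (s≤s b+q≤e) (ℕP.≤-reflexive (≡.sym (ℕP.m+[n∸m]≡n a≤1+e))))

  *-sumLen-≤ : ∀ {α β : ℕ → Carrier} {γ} → (∀ i → 0# ≤ α i) → ∀ a L →
               (∀ i → a ℕ.≤ i → i ℕ.< a ℕ.+ L → γ ≤ β i) →
               γ * sumLen α a L ≤ sumLen (λ i → α i * β i) a L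
  *-sumLen-≤ {γ = γ} α≥0 a zero    γ≤β = ≤-reflexive (zeroʳ γ)
  *-sumLen-≤ {α} {β} {γ} α≥0 a (suc L) γ≤β = begin
    γ * (α a + sumLen α (suc a) L)              ≈⟨ distribˡ γ (α a) _ ⟩
    γ * α a + γ * sumLen α (suc a) L            ≤⟨ +-mono₂-≤ γαa≤αaβa
                                                     (*-sumLen-≤ α≥0 (suc a) L γ≤β-tail) ⟩
    α a * β a + sumLen (λ i → α i * β i) (suc a) L ∎
    where
    γαa≤αaβa : γ * α a ≤ α a * β a
    γαa≤αaβa = ≤-trans (≤-reflexive (*-comm γ (α a)))
                 (*-monoˡ-≤-nonNeg (α≥0 a) (γ≤β a ℕP.≤-refl (ℕP.m<m+n a ℕ.z<s)))
    γ≤β-tail : ∀ i → suc a ℕ.≤ i → i ℕ.< suc a ℕ.+ L → γ ≤ β i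
    γ≤β-tail i a<i i<1+a+L =
      γ≤β i (ℕP.<⇒≤ a<i) (ℕP.<-≤-trans i<1+a+L (ℕP.≤-reflexive (≡.sym (ℕP.+-suc a L))))

  record Crossing (b : ℕ → Carrier) (x : Carrier) (n R : ℕ) : Set ℓ₂ where
    field
      index     : ℕ
      n+index≤R : n ℕ.+ index ℕ.≤ R
      below     : sumLen b n index ≤ x
      above     : x ≤ sumLen b n (suc index)

  module _ {b : ℕ → Carrier} {r : ℕ → ℚ₊ → ℕ} (rate : IsRateOfDivergence b r) where

    rate-≥ : ∀ n x → n ℕ.≤ r n x
    rate-≥ n x with n ℕ.≤? r n x
    ... | yes n≤r = n≤r
    ... | no  n≰r = ⊥-elim (ι-≰-0 x (≡.subst (λ L → ι (proj₁ x) ≤ sumLen b n L)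
                                     (ℕP.m≤n⇒m∸n≡0 (ℕP.≰⇒> n≰r)) (proj₁ rate n x)))

    rate-crossing : ∀ x n → Crossing b (ι (proj₁ x)) n (r n x)
    rate-crossing x n with crossing (λ j → total (sumLen b n j) (ι (proj₁ x))) (ι-nonNeg x) (r n x ℕ.∸ n) x≤Σ
      where
      x≤Σ : ι (proj₁ x) ≤ sumLen b n (suc (r n x ℕ.∸ n))
      x≤Σ = ≡.subst (λ L → ι (proj₁ x) ≤ sumLen b n L) (ℕP.+-∸-assoc 1 (rate-≥ n x)) (proj₁ rate n x)
    ... | k , k≤r-n , below , above = record
      { index = k
      ; n+index≤R = ℕP.≤-trans (ℕP.+-monoʳ-≤ n k≤r-n) (ℕP.≤-reflexive (ℕP.m+[n∸m]≡n (rate-≥ n x)))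
      ; below = below
      ; above = above
      }

  oscillation-bound : ∀ {α β : ℕ → Carrier} {θ a c} {n k} → (∀ i → 0# ≤ α i) → 0# ≤ θ → 0# ≤ a →
    sumLen α n k ≤ c →
    (∀ m → n ℕ.< m → m ℕ.≤ n ℕ.+ k → β n - β m ≤ θ * (Σ[ n , m ℕ.∸ 1 ] α) + a) →
    ∀ i → n ℕ.≤ i → i ℕ.< n ℕ.+ suc k → β n - β i ≤ θ * c + a
  oscillation-bound {α} {β} {θ} {a} {c} {n} {k} α≥0 0≤θ 0≤a Σ≤c osc i n≤i i<n+1+k
    with ℕP.m≤n⇒m<n∨m≡n n≤i
  ... | inj₂ ≡.refl = begin
    β n - β n  ≈⟨ -‿inverseʳ (β n) ⟩
    0#         ≤⟨ +-nonNeg (*-nonneg 0≤θ (≤-trans (sumLen-nonNeg α≥0 n k) Σ≤c)) 0≤a ⟩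
    θ * c + a  ∎
  oscillation-bound {α} {β} {θ} {a} {c} {n} {k} α≥0 0≤θ 0≤a Σ≤c osc (suc i) n≤i i<n+1+k
    | inj₁ n<1+i = begin
    β n - β (suc i)                        ≤⟨ osc (suc i) n<1+i 1+i≤n+k ⟩
    θ * sumLen α n (suc i ℕ.∸ n) + a       ≤⟨ +-mono-≤ a (*-monoˡ-≤-nonNeg 0≤θ
                                                (≤-trans (sumLen-mono-length α≥0 n 1+i-n≤k) Σ≤c)) ⟩
    θ * c + a                              ∎
    where
    1+i≤n+k : suc i ℕ.≤ n ℕ.+ k
    1+i≤n+k = ℕP.≤-pred (ℕP.≤-trans i<n+1+k (ℕP.≤-reflexive (ℕP.+-suc n k)))
    1+i-n≤k : suc i ℕ.∸ n ℕ.≤ k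
    1+i-n≤k = ℕP.≤-trans (ℕP.∸-monoˡ-≤ n 1+i≤n+k) (ℕP.≤-reflexive (ℕP.m+n∸m≡n n k))

  window-estimate : ∀ {α β : ℕ → Carrier} {c δ D} {n L} → (∀ i → 0# ≤ α i) → 0# ≤ c → 0# ≤ D →
    c ≤ sumLen α n L →
    (∀ i → n ℕ.≤ i → i ℕ.< n ℕ.+ L → β n - β i ≤ δ) →
    sumLen (λ i → α i * β i) n L ≤ D →
    β n * c ≤ D + δ * c
  window-estimate {β = β} {c} {δ} {D} {n} 0≤α 0≤c 0≤D c≤Σα osc Σαβ≤D with total (β n) δ
  ... | inj₁ βn≤δ = begin
    β n * c      ≤⟨ *-monoʳ-≤-nonNeg 0≤c βn≤δ ⟩
    δ * c        ≈⟨ +-identityˡ (δ * c) ⟨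
    0# + δ * c   ≤⟨ +-mono-≤ (δ * c) 0≤D ⟩
    D + δ * c    ∎
  window-estimate {α} {β} {c} {δ} {D} {n} {L} 0≤α 0≤c 0≤D c≤Σα osc Σαβ≤D | inj₂ δ≤βn = begin
    β n * c                  ≈⟨ *-congʳ (//-rightDividesˡ δ (β n)) ⟨
    ((β n - δ) + δ) * c      ≈⟨ distribʳ c (β n - δ) δ ⟩
    (β n - δ) * c + δ * c    ≤⟨ +-mono-≤ (δ * c) (begin
      (β n - δ) * c                    ≤⟨ *-monoˡ-≤-nonNeg (x≤y⇒0≤y-x δ≤βn) c≤Σα ⟩
      (β n - δ) * sumLen α n L         ≤⟨ *-sumLen-≤ 0≤α n L (λ i n≤i i<n+L → x-y≤z⇒x-z≤y (osc i n≤i i<n+L)) ⟩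
      sumLen (λ i → α i * β i) n L     ≤⟨ Σαβ≤D ⟩
      D                                ∎) ⟩
    D + δ * c                ∎

  ι-ε²/8θ+[θc+ε/4]c≈εc : ∀ ε θ → let c = proj₁ (ε /₊ (4₊ *₊ θ)) in
    ι (proj₁ ((ε *₊ ε) /₊ (8₊ *₊ θ))) + (ι (proj₁ θ) * ι c + ι (proj₁ (ε /₊ 4₊))) * ι c ≈ ι (proj₁ ε) * ι c
  ι-ε²/8θ+[θc+ε/4]c≈εc ε θ = begin-equality
    ι D + (ι t * ι c + ι a) * ι c      ≈⟨ +-congˡ (*-congʳ (+-congʳ (ι-* t c))) ⟨
    ι D + (ι (t ℚ.* c) + ι a) * ι c    ≈⟨ +-congˡ (*-congʳ (ι-+ (t ℚ.* c) a)) ⟨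
    ι D + ι (t ℚ.* c ℚ.+ a) * ι c      ≈⟨ +-congˡ (ι-* (t ℚ.* c ℚ.+ a) c) ⟨
    ι D + ι ((t ℚ.* c ℚ.+ a) ℚ.* c)    ≈⟨ ι-+ D ((t ℚ.* c ℚ.+ a) ℚ.* c) ⟨
    ι (D ℚ.+ (t ℚ.* c ℚ.+ a) ℚ.* c)    ≡⟨ ≡.cong ι (ε²/8θ+[θc+ε/4]c≡εc ε θ) ⟩
    ι (proj₁ ε ℚ.* c)                  ≈⟨ ι-* (proj₁ ε) c ⟩
    ι (proj₁ ε) * ι c                  ∎
    where
    c = proj₁ (ε /₊ (4₊ *₊ θ))
    D = proj₁ ((ε *₊ ε) /₊ (8₊ *₊ θ))
    t = proj₁ θ
    a = proj₁ (ε /₊ 4₊)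

theorem3p9 : ∀ {c ℓ₁ ℓ₂ : Level} (F : OrderedField c ℓ₁ ℓ₂) →
    let open OrderedField F in
    (α β : ℕ → Carrier) → (∀ i → 0# ≤ α i) → (∀ i → 0# ≤ β i) →
    (r : ℕ → ℚ₊ → ℕ) → IsRateOfDivergence α r →
    (ε : ℚ₊) (g : ℕ → ℕ) (N₁ N₂ : ℕ) (θ : ℚ₊) →
    (Σ[ N₁ , r ((N₁ ℕ.⊔ N₂) ℕ.+ g (N₁ ℕ.⊔ N₂)) (ε /₊ (4₊ *₊ θ)) ] (λ i → α i * β i))
    ≤ ι (proj₁ ((ε *₊ ε) /₊ (8₊ *₊ θ))) →
    (∀ n m → N₂ ℕ.≤ n → n ℕ.< m
    → m ℕ.≤ r ((N₁ ℕ.⊔ N₂) ℕ.+ g (N₁ ℕ.⊔ N₂)) (ε /₊ (4₊ *₊ θ))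
    → β n - β m ≤ (ι (proj₁ θ) * (Σ[ n , m ℕ.∸ 1 ] α)) + ι (proj₁ (ε /₊ 4₊))) →
    ∀ n → (N₁ ℕ.⊔ N₂) ℕ.≤ n → n ℕ.≤ (N₁ ℕ.⊔ N₂) ℕ.+ g (N₁ ℕ.⊔ N₂) → β n ≤ ι (proj₁ ε)
theorem3p9 F α β α≥0 β≥0 r rate ε g N₁ N₂ θ Σαβ≤D osc n N≤n n≤N+gN = *-cancelʳ-≤-pos c (begin
    β n * ι (proj₁ c)  ≤⟨ window-estimate α≥0 (ι-nonNeg c) (ι-nonNeg D) above
                            (oscillation-bound α≥0 (ι-nonNeg θ) (ι-nonNeg (ε /₊ 4₊)) below osc-window)
                            (≤-trans (sumLen≤Σ αβ≥0 index N₁≤n n+index≤R) Σαβ≤D) ⟩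
    ι (proj₁ D) + (ι (proj₁ θ) * ι (proj₁ c) + ι (proj₁ (ε /₊ 4₊))) * ι (proj₁ c)
                       ≈⟨ ι-ε²/8θ+[θc+ε/4]c≈εc ε θ ⟩
    ι (proj₁ ε) * ι (proj₁ c) ∎)
  where
  open OrderedField F
  open OrderedFieldProperties F
  open import Relation.Binary.Reasoning.PartialOrder (TotalOrder.poset ≤-totalOrder)
  N = N₁ ℕ.⊔ N₂
  c = ε /₊ (4₊ *₊ θ)
  D = (ε *₊ ε) /₊ (8₊ *₊ θ)
  R = r (N ℕ.+ g N) c
  open Crossing (rate-crossing rate c n) renaming (n+index≤R to n+index≤r[n,c])
  n+index≤R : n ℕ.+ index ℕ.≤ R
  n+index≤R = ℕP.≤-trans n+index≤r[n,c] (proj₂ rate c n≤N+gN)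
  N₁≤n : N₁ ℕ.≤ n
  N₁≤n = ℕP.≤-trans (ℕP.m≤m⊔n N₁ N₂) N≤n
  αβ≥0 : ∀ i → 0# ≤ α i * β i
  αβ≥0 i = *-nonneg (α≥0 i) (β≥0 i)
  osc-window : ∀ m → n ℕ.< m → m ℕ.≤ n ℕ.+ index →
               β n - β m ≤ ι (proj₁ θ) * (Σ[ n , m ℕ.∸ 1 ] α) + ι (proj₁ (ε /₊ 4₊))
  osc-window m n<m m≤n+index =
    osc n m (ℕP.≤-trans (ℕP.m≤n⊔m N₁ N₂) N≤n) n<m (ℕP.≤-trans m≤n+index n+index≤R)
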